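{- Let $n\geq 3$ and let $j_1,j_2$ be integers with $2\leq j_1<j_2\leq n$. Then the subgraph of the augmented cube $AQ_n$ induced by the edge set $$\Big(\bigcup_{i\in\{2,\dots,n\}\setminus\{j_2\}}E_i\Big)\cup E_{\leq j_1}\cup E_{\leq j_2}$$ (that is, $E_2\cup\cdots\cup E_{j_1}\cup E_{\leq j_1}\cup E_{j_1+1}\cup\cdots\cup E_{j_2-1}\cup E_{\leq j_2}\cup E_{j_2+1}\cup\cdots\cup E_n$) is isomorphic to the hypercube $Q_n$.
   Context: The hypercube $Q_n$ has vertex set $\{0,1\}^n$, two vertices adjacent iff they differ in exactly one bit. The augmented cube $AQ_n$ has vertex set $\{0,1\}^n$ (strings $x_n\cdots x_1$) and edge set $\left(\bigcup_{i=1}^n E_i\right)\cup\left(\bigcup_{j=2}^n E_{\leq j}\right)$, where $E_i=\{(x_n\cdots x_1,\ x_n\cdots x_{i+1}(x_i+1)x_{i-1}\cdots x_1)\}$ (hypercube edges of dimension $i$: flip bit $i$) and $E_{\leq j}=\{(x_n\cdots x_1,\ x_n\cdots x_{j+1}(x_j+1)\cdots(x_1+1))\}$ (augmented edges of dimension $j$: flip bits $1,\dots,j$), addition mod 2. -}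

module Defs where

open import Data.Nat using (ℕ; suc; _≤_; _<_; _≤ᵇ_; _<ᵇ_; _≡ᵇ_)
open import Data.Bool using (Bool; not; if_then_else_)
open import Data.Fin using (Fin; toℕ)
open import Data.Vec using (Vec; lookup; tabulate)
open import Data.Product using (Σ; _×_)
open import Data.Sum using (_⊎_)
open import Relation.Binary.PropositionalEquality using (_≡_)
open import Relation.Nullary using (¬_)

-- A vertex of Q_n / AQ_n: a bit string x_n ⋯ x_1, stored as a vector
-- whose position k (0-based, Fin n) holds the bit x_{k+1}.
Vertex : ℕ → Set
Vertex n = Vec Bool n

flipBit : {n : ℕ} → ℕ → Vertex n → Vertex n
flipBit i x = tabulate λ k → if suc (toℕ k) ≡ᵇ i then not (lookup x k) else lookup x k

flipLow : {n : ℕ} → ℕ → Vertex n → Vertex n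
flipLow j x = tabulate λ k → if toℕ k <ᵇ j then not (lookup x k) else lookup x k

InE : {n : ℕ} → ℕ → Vertex n → Vertex n → Set
InE i x y = y ≡ flipBit i x

InE≤ : {n : ℕ} → ℕ → Vertex n → Vertex n → Set
InE≤ j x y = y ≡ flipLow j x

QAdj : (n : ℕ) → Vertex n → Vertex n → Set
QAdj n x y = Σ ℕ λ i → (1 ≤ i × i ≤ n) × InE i x y

HAdj : (n j₁ j₂ : ℕ) → Vertex n → Vertex n → Set
HAdj n j₁ j₂ x y =
  (Σ ℕ λ i → (2 ≤ i × i ≤ n) × ¬ (i ≡ j₂) × InE i x y)
  ⊎ InE≤ j₁ x y
  ⊎ InE≤ j₂ x y

-- Both graphs are Cayley graphs of the group (ℤ/2)ⁿ: Q_n with generators e₁, …, eₙ, and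
-- the subgraph of AQ_n with generators e_i (i ∉ {1, j₂}), L_{j₁} = e₁ + ⋯ + e_{j₁} and L_{j₂}.
-- A linear automorphism ψ with ψ e₁ = L_{j₁}, ψ e_{j₂} = L_{j₂} fixing the other e_i
-- therefore maps Q_n isomorphically onto the subgraph. It is the product of the transvections
-- x ↦ x + x₁ (e₁ + L_{j₁}) and x ↦ x + x_{j₂} (e_{j₂} + L_{j₂}); each is an involution
-- because its shift vector vanishes at its own pivot coordinate, and the second one fixes
-- L_{j₁} since j₁ < j₂.

module Submission where

open import Defs
open import Data.Nat using (ℕ; suc; _≤_; _<_; _≡ᵇ_; _<ᵇ_; z≤n; s≤s)
open import Data.Nat.Properties
  using (_≟_; _<?_; ≤-refl; ≤-trans; <⇒≤; <⇒≢; <⇒≱; ≤∧≢⇒<)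
open import Data.Bool using (Bool; true; false; not; _∧_; _xor_; if_then_else_)
open import Data.Bool.Properties
  using (∧-zeroʳ; xor-assoc; xor-comm; xor-identityˡ; xor-identityʳ; xor-same)
open import Data.Fin using (Fin; toℕ; fromℕ<)
open import Data.Fin.Properties using (toℕ-fromℕ<)
open import Data.Vec using ([]; _∷_; lookup; tabulate; zipWith; replicate)
open import Data.Vec.Properties
  using (zipWith-assoc; zipWith-comm; zipWith-identityˡ; zipWith-identityʳ; zipWith-inverseˡ;
         map-id; lookup-zipWith; lookup-replicate; lookup∘tabulate)
open import Data.Product using (Σ; _,_; proj₁; proj₂)
open import Data.Sum using (inj₁; inj₂)
open import Function using (_∘_)
open import Function.Bundles using (_⤖_; Bijection; Equivalence; _⇔_; mk⇔; mk↔ₛ′)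
open import Function.Properties.Inverse using (↔⇒⤖)
open import Relation.Nullary using (yes; no)
open import Relation.Nullary.Decidable using (dec-true; dec-false)
open import Relation.Binary.PropositionalEquality
  using (_≡_; _≢_; refl; sym; trans; cong; cong₂; subst; module ≡-Reasoning)

private
  variable
    n i j : ℕ
    x : Vertex n

infixl 6 _⊕_
infix 7 _·_

_⊕_ : Vertex n → Vertex n → Vertex n
_⊕_ = zipWith _xor_

0̄ : Vertex n
0̄ = replicate _ false

_·_ : Bool → Vertex n → Vertex n
true  · v = v
false · v = 0̄

⊕-assoc : (x y z : Vertex n) → x ⊕ y ⊕ z ≡ x ⊕ (y ⊕ z)
⊕-assoc = zipWith-assoc xor-assoc

⊕-comm : (x y : Vertex n) → x ⊕ y ≡ y ⊕ x
⊕-comm = zipWith-comm xor-comm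

⊕-identityˡ : (x : Vertex n) → 0̄ ⊕ x ≡ x
⊕-identityˡ = zipWith-identityˡ xor-identityˡ

⊕-identityʳ : (x : Vertex n) → x ⊕ 0̄ ≡ x
⊕-identityʳ = zipWith-identityʳ xor-identityʳ

⊕-self : (x : Vertex n) → x ⊕ x ≡ 0̄
⊕-self x = trans (cong (_⊕ x) (sym (map-id x))) (zipWith-inverseˡ xor-same x)

⊕-cancelˡ : (x y : Vertex n) → x ⊕ (x ⊕ y) ≡ y
⊕-cancelˡ x y = begin
  x ⊕ (x ⊕ y)  ≡⟨ sym (⊕-assoc x x y) ⟩
  x ⊕ x ⊕ y    ≡⟨ cong (_⊕ y) (⊕-self x) ⟩
  0̄ ⊕ y        ≡⟨ ⊕-identityˡ y ⟩
  y            ∎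
  where open ≡-Reasoning

⊕-cancelʳ : (x y : Vertex n) → x ⊕ y ⊕ y ≡ x
⊕-cancelʳ x y = begin
  x ⊕ y ⊕ y    ≡⟨ ⊕-assoc x y y ⟩
  x ⊕ (y ⊕ y)  ≡⟨ cong (x ⊕_) (⊕-self y) ⟩
  x ⊕ 0̄        ≡⟨ ⊕-identityʳ x ⟩
  x            ∎
  where open ≡-Reasoning

⊕-interchange : (x y z w : Vertex n) → x ⊕ y ⊕ (z ⊕ w) ≡ x ⊕ z ⊕ (y ⊕ w)
⊕-interchange x y z w = begin
  x ⊕ y ⊕ (z ⊕ w)    ≡⟨ ⊕-assoc x y (z ⊕ w) ⟩
  x ⊕ (y ⊕ (z ⊕ w))  ≡⟨ cong (x ⊕_) (sym (⊕-assoc y z w)) ⟩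
  x ⊕ (y ⊕ z ⊕ w)    ≡⟨ cong (λ t → x ⊕ (t ⊕ w)) (⊕-comm y z) ⟩
  x ⊕ (z ⊕ y ⊕ w)    ≡⟨ cong (x ⊕_) (⊕-assoc z y w) ⟩
  x ⊕ (z ⊕ (y ⊕ w))  ≡⟨ sym (⊕-assoc x z (y ⊕ w)) ⟩
  x ⊕ z ⊕ (y ⊕ w)    ∎
  where open ≡-Reasoning

·-distribʳ-xor : (a b : Bool) (v : Vertex n) → (a xor b) · v ≡ a · v ⊕ b · v
·-distribʳ-xor true  true  v = sym (⊕-self v)
·-distribʳ-xor true  false v = sym (⊕-identityʳ v)
·-distribʳ-xor false b     v = sym (⊕-identityˡ (b · v))

lookup-· : (b : Bool) (v : Vertex n) (k : Fin n) → lookup (b · v) k ≡ b ∧ lookup v k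
lookup-· true  v k = refl
lookup-· false v k = lookup-replicate k false

Linear : (Vertex n → Vertex n) → Set
Linear f = ∀ x y → f (x ⊕ y) ≡ f x ⊕ f y

∘-linear : {f g : Vertex n → Vertex n} → Linear f → Linear g → Linear (f ∘ g)
∘-linear {f = f} {g} f-linear g-linear x y =
  trans (cong f (g-linear x y)) (f-linear (g x) (g y))

transvection : Fin n → Vertex n → Vertex n → Vertex n
transvection p v x = x ⊕ lookup x p · v

module _ (p : Fin n) (v : Vertex n) where

  private
    τ : Vertex n → Vertex n
    τ = transvection p v

  transvection-linear : Linear τ
  transvection-linear x y = begin
    x ⊕ y ⊕ lookup (x ⊕ y) p · v  ≡⟨ cong (λ c → x ⊕ y ⊕ c · v) (lookup-zipWith _xor_ p x y) ⟩
    x ⊕ y ⊕ (a xor b) · v         ≡⟨ cong (x ⊕ y ⊕_) (·-distribʳ-xor a b v) ⟩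
    x ⊕ y ⊕ (a · v ⊕ b · v)       ≡⟨ ⊕-interchange x y (a · v) (b · v) ⟩
    x ⊕ a · v ⊕ (y ⊕ b · v)       ∎
    where
    open ≡-Reasoning
    a b : Bool
    a = lookup x p
    b = lookup y p

  transvection-fixes : lookup x p ≡ false → τ x ≡ x
  transvection-fixes {x} x[p]≡false = trans (cong (λ c → x ⊕ c · v) x[p]≡false) (⊕-identityʳ x)

  transvection-shifts : lookup x p ≡ true → τ x ≡ x ⊕ v
  transvection-shifts {x} x[p]≡true = cong (λ c → x ⊕ c · v) x[p]≡true

  module _ (v[p]≡false : lookup v p ≡ false) where

    transvection-preserves-pivot : ∀ x → lookup (τ x) p ≡ lookup x p
    transvection-preserves-pivot x = begin
      lookup (x ⊕ a · v) p    ≡⟨ lookup-zipWith _xor_ p x (a · v) ⟩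
      a xor lookup (a · v) p  ≡⟨ cong (a xor_) (trans (lookup-· a v p) (cong (a ∧_) v[p]≡false)) ⟩
      a xor (a ∧ false)       ≡⟨ cong (a xor_) (∧-zeroʳ a) ⟩
      a xor false             ≡⟨ xor-identityʳ a ⟩
      a                       ∎
      where
      open ≡-Reasoning
      a : Bool
      a = lookup x p

    transvection-involutive : ∀ x → τ (τ x) ≡ x
    transvection-involutive x = begin
      τ x ⊕ lookup (τ x) p · v  ≡⟨ cong (λ c → τ x ⊕ c · v) (transvection-preserves-pivot x) ⟩
      τ x ⊕ lookup x p · v      ≡⟨ ⊕-cancelʳ x (lookup x p · v) ⟩
      x                         ∎
      where open ≡-Reasoning

unit : ℕ → Vertex n
unit i = tabulate λ k → suc (toℕ k) ≡ᵇ i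

low : ℕ → Vertex n
low j = tabulate λ k → toℕ k <ᵇ j

tabulate-flip : (c : Fin n → Bool) (x : Vertex n) →
  tabulate (λ k → if c k then not (lookup x k) else lookup x k) ≡ tabulate c ⊕ x
tabulate-flip c []      = refl
tabulate-flip c (a ∷ x) = cong₂ _∷_ (if-not≡xor (c Fin.zero) a) (tabulate-flip (c ∘ Fin.suc) x)
  where
  if-not≡xor : ∀ b a → (if b then not a else a) ≡ b xor a
  if-not≡xor true  a = refl
  if-not≡xor false a = refl

flipBit≡unit⊕ : ∀ i (x : Vertex n) → flipBit i x ≡ unit i ⊕ x
flipBit≡unit⊕ i = tabulate-flip _

flipLow≡low⊕ : ∀ j (x : Vertex n) → flipLow j x ≡ low j ⊕ x
flipLow≡low⊕ j = tabulate-flip _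

module _ {k : Fin n} (k-holds-bit-i : suc (toℕ k) ≡ i) where

  unit-own-bit : lookup (unit i) k ≡ true
  unit-own-bit = trans (lookup∘tabulate _ k) (dec-true (suc (toℕ k) ≟ i) k-holds-bit-i)

  unit-other-bit : i ≢ j → lookup (unit j) k ≡ false
  unit-other-bit i≢j =
    trans (lookup∘tabulate _ k) (dec-false (suc (toℕ k) ≟ _) (i≢j ∘ trans (sym k-holds-bit-i)))

  low-bit-≤ : i ≤ j → lookup (low j) k ≡ true
  low-bit-≤ i≤j =
    trans (lookup∘tabulate _ k) (dec-true (toℕ k <? _) (subst (_≤ _) (sym k-holds-bit-i) i≤j))

  low-bit-> : j < i → lookup (low j) k ≡ false
  low-bit-> j<i =
    trans (lookup∘tabulate _ k) (dec-false (toℕ k <? _) (<⇒≱ j<i ∘ subst (_≤ _) k-holds-bit-i))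

bitPosition : ∀ i → 1 ≤ i → i ≤ n → Σ (Fin n) λ k → suc (toℕ k) ≡ i
bitPosition (suc i) _ i<n = fromℕ< i<n , cong suc (toℕ-fromℕ< i<n)

module LinearIsomorphism {φ ψ : Vertex n → Vertex n} (φ-linear : Linear φ) (ψ-linear : Linear ψ)
         (ψ∘φ : ∀ x → ψ (φ x) ≡ x) (φ∘ψ : ∀ x → φ (ψ x) ≡ x) where

  translation-transport : ∀ {u v} {s t : Vertex n → Vertex n} →
    (∀ z → s z ≡ v ⊕ z) → (∀ z → t z ≡ u ⊕ z) → ψ u ≡ v →
    ∀ x y → y ≡ s x ⇔ φ y ≡ t (φ x)
  translation-transport {u} {v} {s} {t} s≡v⊕ t≡u⊕ ψu≡v x y = mk⇔ forward backward
    where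
    open ≡-Reasoning
    forward : y ≡ s x → φ y ≡ t (φ x)
    forward y≡sx = begin
      φ y            ≡⟨ cong φ (trans y≡sx (s≡v⊕ x)) ⟩
      φ (v ⊕ x)      ≡⟨ φ-linear v x ⟩
      φ v ⊕ φ x      ≡⟨ cong (λ w → φ w ⊕ φ x) (sym ψu≡v) ⟩
      φ (ψ u) ⊕ φ x  ≡⟨ cong (_⊕ φ x) (φ∘ψ u) ⟩
      u ⊕ φ x        ≡⟨ sym (t≡u⊕ (φ x)) ⟩
      t (φ x)        ∎
    backward : φ y ≡ t (φ x) → y ≡ s x
    backward φy≡tφx = begin
      y              ≡⟨ sym (ψ∘φ y) ⟩
      ψ (φ y)        ≡⟨ cong ψ (trans φy≡tφx (t≡u⊕ (φ x))) ⟩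
      ψ (u ⊕ φ x)    ≡⟨ ψ-linear u (φ x) ⟩
      ψ u ⊕ ψ (φ x)  ≡⟨ cong₂ _⊕_ ψu≡v (ψ∘φ x) ⟩
      v ⊕ x          ≡⟨ sym (s≡v⊕ x) ⟩
      s x            ∎

module HypercubeIsomorphism {n j₁ j₂ : ℕ} (2≤j₁ : 2 ≤ j₁) (j₁<j₂ : j₁ < j₂) (j₂≤n : j₂ ≤ n) where

  private
    1≤j₁ : 1 ≤ j₁
    1≤j₁ = ≤-trans (s≤s z≤n) 2≤j₁

    1<j₂ : 1 < j₂
    1<j₂ = ≤-trans 2≤j₁ (<⇒≤ j₁<j₂)

    1≤n : 1 ≤ n
    1≤n = ≤-trans (<⇒≤ 1<j₂) j₂≤n

    p₁ p₂ : Fin n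
    p₁ = proj₁ (bitPosition 1 ≤-refl 1≤n)
    p₂ = proj₁ (bitPosition j₂ (<⇒≤ 1<j₂) j₂≤n)

    p₁-holds-bit-1 : suc (toℕ p₁) ≡ 1
    p₁-holds-bit-1 = proj₂ (bitPosition 1 ≤-refl 1≤n)

    p₂-holds-bit-j₂ : suc (toℕ p₂) ≡ j₂
    p₂-holds-bit-j₂ = proj₂ (bitPosition j₂ (<⇒≤ 1<j₂) j₂≤n)

    v₁ v₂ : Vertex n
    v₁ = unit 1 ⊕ low j₁
    v₂ = unit j₂ ⊕ low j₂

    v₁[p₁]≡false : lookup v₁ p₁ ≡ false
    v₁[p₁]≡false = trans (lookup-zipWith _xor_ p₁ (unit 1) (low j₁))
      (cong₂ _xor_ (unit-own-bit p₁-holds-bit-1) (low-bit-≤ p₁-holds-bit-1 1≤j₁))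

    v₂[p₂]≡false : lookup v₂ p₂ ≡ false
    v₂[p₂]≡false = trans (lookup-zipWith _xor_ p₂ (unit j₂) (low j₂))
      (cong₂ _xor_ (unit-own-bit p₂-holds-bit-j₂) (low-bit-≤ p₂-holds-bit-j₂ ≤-refl))

    τ₁ τ₂ : Vertex n → Vertex n
    τ₁ = transvection p₁ v₁
    τ₂ = transvection p₂ v₂

  φ ψ : Vertex n → Vertex n
  φ = τ₁ ∘ τ₂
  ψ = τ₂ ∘ τ₁

  φ-linear : Linear φ
  φ-linear = ∘-linear (transvection-linear p₁ v₁) (transvection-linear p₂ v₂)

  ψ-linear : Linear ψ
  ψ-linear = ∘-linear (transvection-linear p₂ v₂) (transvection-linear p₁ v₁)

  ψ∘φ : ∀ x → ψ (φ x) ≡ x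
  ψ∘φ x = trans (cong τ₂ (transvection-involutive p₁ v₁ v₁[p₁]≡false (τ₂ x)))
                (transvection-involutive p₂ v₂ v₂[p₂]≡false x)

  φ∘ψ : ∀ x → φ (ψ x) ≡ x
  φ∘ψ x = trans (cong τ₁ (transvection-involutive p₂ v₂ v₂[p₂]≡false (τ₁ x)))
                (transvection-involutive p₁ v₁ v₁[p₁]≡false x)

  ψ-unit₁ : ψ (unit 1) ≡ low j₁
  ψ-unit₁ = begin
    τ₂ (τ₁ (unit 1))  ≡⟨ cong τ₂ (transvection-shifts p₁ v₁ (unit-own-bit p₁-holds-bit-1)) ⟩
    τ₂ (unit 1 ⊕ v₁)  ≡⟨ cong τ₂ (⊕-cancelˡ (unit 1) (low j₁)) ⟩
    τ₂ (low j₁)       ≡⟨ transvection-fixes p₂ v₂ (low-bit-> p₂-holds-bit-j₂ j₁<j₂) ⟩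
    low j₁            ∎
    where open ≡-Reasoning

  ψ-unit-j₂ : ψ (unit j₂) ≡ low j₂
  ψ-unit-j₂ = begin
    τ₂ (τ₁ (unit j₂))  ≡⟨ cong τ₂ (transvection-fixes p₁ v₁ (unit-other-bit p₁-holds-bit-1 (<⇒≢ 1<j₂))) ⟩
    τ₂ (unit j₂)       ≡⟨ transvection-shifts p₂ v₂ (unit-own-bit p₂-holds-bit-j₂) ⟩
    unit j₂ ⊕ v₂       ≡⟨ ⊕-cancelˡ (unit j₂) (low j₂) ⟩
    low j₂             ∎
    where open ≡-Reasoning

  ψ-unit : 2 ≤ i → i ≢ j₂ → ψ (unit i) ≡ unit i
  ψ-unit 2≤i i≢j₂ =
    trans (cong τ₂ (transvection-fixes p₁ v₁ (unit-other-bit p₁-holds-bit-1 (<⇒≢ 2≤i))))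
          (transvection-fixes p₂ v₂ (unit-other-bit p₂-holds-bit-j₂ (i≢j₂ ∘ sym)))

  open LinearIsomorphism φ-linear ψ-linear ψ∘φ φ∘ψ

  InE-transport : 2 ≤ i → i ≢ j₂ → ∀ x y → InE i x y ⇔ InE i (φ x) (φ y)
  InE-transport {i} 2≤i i≢j₂ =
    translation-transport (flipBit≡unit⊕ i) (flipBit≡unit⊕ i) (ψ-unit 2≤i i≢j₂)

  InE≤j₁-transport : ∀ x y → InE≤ j₁ x y ⇔ InE 1 (φ x) (φ y)
  InE≤j₁-transport = translation-transport (flipLow≡low⊕ j₁) (flipBit≡unit⊕ 1) ψ-unit₁

  InE≤j₂-transport : ∀ x y → InE≤ j₂ x y ⇔ InE j₂ (φ x) (φ y)
  InE≤j₂-transport = translation-transport (flipLow≡low⊕ j₂) (flipBit≡unit⊕ j₂) ψ-unit-j₂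

  adjacency : ∀ x y → HAdj n j₁ j₂ x y ⇔ QAdj n (φ x) (φ y)
  adjacency x y = mk⇔ forward backward
    where
    forward : HAdj n j₁ j₂ x y → QAdj n (φ x) (φ y)
    forward (inj₁ (i , (2≤i , i≤n) , i≢j₂ , e)) =
      i , (≤-trans (s≤s z≤n) 2≤i , i≤n) , Equivalence.to (InE-transport 2≤i i≢j₂ x y) e
    forward (inj₂ (inj₁ e)) = 1 , (≤-refl , 1≤n) , Equivalence.to (InE≤j₁-transport x y) e
    forward (inj₂ (inj₂ e)) = j₂ , (<⇒≤ 1<j₂ , j₂≤n) , Equivalence.to (InE≤j₂-transport x y) e

    backward : QAdj n (φ x) (φ y) → HAdj n j₁ j₂ x y
    backward (i , (1≤i , i≤n) , e) with i ≟ 1 | i ≟ j₂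
    ... | yes refl | _        = inj₂ (inj₁ (Equivalence.from (InE≤j₁-transport x y) e))
    ... | no _     | yes refl = inj₂ (inj₂ (Equivalence.from (InE≤j₂-transport x y) e))
    ... | no i≢1   | no i≢j₂  =
      inj₁ (i , (2≤i , i≤n) , i≢j₂ , Equivalence.from (InE-transport 2≤i i≢j₂ x y) e)
      where
      2≤i : 2 ≤ i
      2≤i = ≤∧≢⇒< 1≤i (i≢1 ∘ sym)

  bijection : Vertex n ⤖ Vertex n
  bijection = ↔⇒⤖ (mk↔ₛ′ φ ψ φ∘ψ ψ∘φ)

-- The hypothesis 3 ≤ n is implied by 2 ≤ j₁ < j₂ ≤ n.
lemma3p3 : (n j₁ j₂ : ℕ) → 3 ≤ n → 2 ≤ j₁ → j₁ < j₂ → j₂ ≤ n →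
    Σ (Vertex n ⤖ Vertex n) λ f →
      (x y : Vertex n) → HAdj n j₁ j₂ x y ⇔ QAdj n (Bijection.to f x) (Bijection.to f y)
lemma3p3 n j₁ j₂ _ 2≤j₁ j₁<j₂ j₂≤n = bijection , adjacency
  where open HypercubeIsomorphism 2≤j₁ j₁<j₂ j₂≤n
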